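{- Let $p$ be a prime number and let \[T(p):=\frac{1}{5}\left( (1+\sqrt{5}) \left( \frac{3+\sqrt{5}}{2} \right)^{2p}+(1-\sqrt{5}) \left( \frac{3-\sqrt{5}}{2} \right)^{2p}+3\right),\] which is an integer. Then: (1) if $p \equiv 1 \pmod{5}$, then $T(p)$ is divisible by $5$; (2) if $p \equiv 3 \pmod{5}$, then $T(p)$ is divisible by $11$; (3) if $p \equiv 2 \pmod{15}$, then $T(p)$ is divisible by $31$. -}

module Defs where

open import Data.Nat using (ℕ; zero; suc)
open import Data.Integer using (ℤ; +_; -[1+_])
open import Data.Rational using (ℚ; _/_; 0ℚ; 1ℚ)
import Data.Rational as Q
open import Data.Product using (_×_; _,_)

-- Elements a + b√5 of the field ℚ(√5), represented as pairs (a , b).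
Q√5 : Set
Q√5 = ℚ × ℚ

ι : ℚ → Q√5
ι a = (a , 0ℚ)

√5 : Q√5
√5 = (0ℚ , 1ℚ)

infixl 6 _⊕_ _⊖_
infixl 7 _⊛_
infixr 8 _^^_

_⊕_ : Q√5 → Q√5 → Q√5
(a , b) ⊕ (c , d) = (a Q.+ c , b Q.+ d)

_⊖_ : Q√5 → Q√5 → Q√5
(a , b) ⊖ (c , d) = (a Q.- c , b Q.- d)

_⊛_ : Q√5 → Q√5 → Q√5
(a , b) ⊛ (c , d) = (a Q.* c Q.+ (+ 5 / 1) Q.* (b Q.* d) , a Q.* d Q.+ b Q.* c)

_^^_ : Q√5 → ℕ → Q√5
x ^^ zero = ι 1ℚ
x ^^ suc n = x ⊛ (x ^^ n)

T : ℕ → Q√5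
T p = ι (+ 1 / 5) ⊛
        ( (ι 1ℚ ⊕ √5) ⊛ (ι (+ 1 / 2) ⊛ (ι (+ 3 / 1) ⊕ √5)) ^^ (2 Data.Nat.* p)
        ⊕ (ι 1ℚ ⊖ √5) ⊛ (ι (+ 1 / 2) ⊛ (ι (+ 3 / 1) ⊖ √5)) ^^ (2 Data.Nat.* p)
        ⊕ ι (+ 3 / 1) )

module Submission where

-- Write y = (3+√5)/2 and ȳ = (3-√5)/2 for its conjugate.  The powers of y have the
-- shape  y^n = (a_n + b_n/2) + (b_n/2)√5  for natural numbers (a_n , b_n) obeying
-- (a₀ , b₀) = (1 , 0) and (a_{n+1} , b_{n+1}) = (a_n + b_n , a_n + 2b_n), and ȳ^n is
-- the conjugate of y^n since conjugation is a ring automorphism of ℚ(√5).  The two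
-- summands of T(p) are therefore conjugate, their sum is twice a rational part, and
-- T(p) = S(2p)/5 with the natural number  S(n) = 2a_n + 6b_n + 3.
--
-- The divisibility claims are statements about S(2p) modulo 25, 55 and 155, all of
-- which divide M = 8525 = 25·11·31.  Reduced modulo M the pair sequence (a_n , b_n)
-- is periodic with period 150, so S(2p) ≡ S(2(p mod 75)) (mod M), and the 75
-- remaining cases j = p mod 75 are settled by a decision procedure.

open import Defs
open import Data.Nat as ℕ using (ℕ; zero; suc; _+_; _*_; _%_; _≟_; _<_; NonZero)
open import Data.Nat.Properties using (allUpTo?)
open import Data.Nat.DivMod
  using (%-distribˡ-+; %-distribˡ-*; m%n%n≡m%n; m≡m%n+[m/n]*n; m%n<n; m/n*n≡m; m∣n⇒o%n%m≡o%m)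
open import Data.Nat.Divisibility as ℕ∣ using (divides; _∣?_; *-cancelʳ-∣; ∣n∣m%n⇒∣m; %-presˡ-∣)
open import Data.Nat.GeneralisedArithmetic using (fold; fold-+)
open import Data.Nat.Coprimality using (Coprime; 1-coprimeTo)
import Data.Nat.Coprimality as Coprimality
open import Data.Nat.Primality using (Prime)
open import Data.Integer as ℤ using (+_)
open import Data.Integer.Properties using (pos-+; pos-*)
open import Data.Integer.Divisibility using (_∣_)
open import Data.Rational using (ℚ; _/_; mkℚ; 0ℚ; 1ℚ)
import Data.Rational as Q
open import Data.Rational.Properties using (normalize-coprime; toℚᵘ-injective; toℚᵘ-homo-+; toℚᵘ-homo-*)
import Data.Rational.Unnormalised as ℚᵘ
import Data.Rational.Unnormalised.Properties as ℚᵘ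
import Data.Rational.Solver as ℚ-Solver
import Data.Integer.Solver as ℤ-Solver
import Data.Nat.Solver as ℕ-Solver
open import Data.Product using (_×_; _,_; proj₁; proj₂; ∃-syntax)
open import Function using (_∘_)
open import Relation.Nullary using (Dec)
open import Relation.Nullary.Decidable using (from-yes; _×-dec_; _→-dec_)
open import Relation.Binary.PropositionalEquality
open ≡-Reasoning

fromℕ : ℕ → ℚ
fromℕ n = + n / 1

-- fromℕ n is already in lowest terms, which lets us compute with it in ℚᵘ.
coprime-1 : ∀ n → Coprime n 1
coprime-1 n = Coprimality.sym (1-coprimeTo n)

fromℕ-lowest : ℕ → ℚ
fromℕ-lowest n = mkℚ (+ n) 0 (coprime-1 n)

fromℕ-canonical : ∀ n → fromℕ n ≡ fromℕ-lowest n
fromℕ-canonical n = normalize-coprime (coprime-1 n)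

fromℕ-homo-+ : ∀ m n → fromℕ (m + n) ≡ fromℕ m Q.+ fromℕ n
fromℕ-homo-+ m n rewrite fromℕ-canonical m | fromℕ-canonical n | fromℕ-canonical (m + n) =
  toℚᵘ-injective (ℚᵘ.≃-trans (ℚᵘ.*≡* cross-multiplied) (ℚᵘ.≃-sym (toℚᵘ-homo-+ (fromℕ-lowest m) (fromℕ-lowest n))))
  where
  open ℤ-Solver.+-*-Solver
  cross-multiplied : + (m + n) ℤ.* (+ 1 ℤ.* + 1) ≡ (+ m ℤ.* + 1 ℤ.+ + n ℤ.* + 1) ℤ.* + 1
  cross-multiplied = trans (cong (ℤ._* + 1) (pos-+ m n))
    (solve 2 (λ a b → (a :+ b) :* (con (+ 1) :* con (+ 1)) := (a :* con (+ 1) :+ b :* con (+ 1)) :* con (+ 1))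
           refl (+ m) (+ n))

fromℕ-homo-* : ∀ m n → fromℕ (m * n) ≡ fromℕ m Q.* fromℕ n
fromℕ-homo-* m n rewrite fromℕ-canonical m | fromℕ-canonical n | fromℕ-canonical (m * n) =
  toℚᵘ-injective (ℚᵘ.≃-trans (ℚᵘ.*≡* cross-multiplied) (ℚᵘ.≃-sym (toℚᵘ-homo-* (fromℕ-lowest m) (fromℕ-lowest n))))
  where
  open ℤ-Solver.+-*-Solver
  cross-multiplied : + (m * n) ℤ.* (+ 1 ℤ.* + 1) ≡ (+ m ℤ.* + n) ℤ.* + 1
  cross-multiplied = trans (cong (ℤ._* + 1) (pos-* m n))
    (solve 2 (λ a b → (a :* b) :* (con (+ 1) :* con (+ 1)) := (a :* b) :* con (+ 1)) refl (+ m) (+ n))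

conj : Q√5 → Q√5
conj (a , b) = (a , Q.- b)

conj-⊛ : ∀ x w → conj (x ⊛ w) ≡ conj x ⊛ conj w
conj-⊛ (a , b) (c , d) = cong₂ _,_
  (solve 4 (λ a b c d → a :* c :+ con (fromℕ 5) :* (b :* d) := a :* c :+ con (fromℕ 5) :* (:- b :* :- d)) refl a b c d)
  (solve 4 (λ a b c d → :- (a :* d :+ b :* c) := a :* :- d :+ :- b :* c) refl a b c d)
  where open ℚ-Solver.+-*-Solver

conj-^^ : ∀ x n → conj x ^^ n ≡ conj (x ^^ n)
conj-^^ x zero    = refl
conj-^^ x (suc n) = begin
  conj x ⊛ conj x ^^ n    ≡⟨ cong (conj x ⊛_) (conj-^^ x n) ⟩
  conj x ⊛ conj (x ^^ n)  ≡⟨ conj-⊛ x (x ^^ n) ⟨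
  conj (x ⊛ x ^^ n)       ∎

trace : ∀ w → w ⊕ conj w ≡ ι (proj₁ w Q.+ proj₁ w)
trace (a , b) = cong (a Q.+ a ,_) (solve 1 (λ b → b :+ :- b := con 0ℚ) refl b)
  where open ℚ-Solver.+-*-Solver

ι-⊛ : ∀ a b → ι a ⊛ ι b ≡ ι (a Q.* b)
ι-⊛ a b = cong₂ _,_
  (solve 2 (λ a b → a :* b :+ con (fromℕ 5) :* (con 0ℚ :* con 0ℚ) := a :* b) refl a b)
  (solve 2 (λ a b → a :* con 0ℚ :+ con 0ℚ :* b := con 0ℚ) refl a b)
  where open ℚ-Solver.+-*-Solver

-- One step of the coefficient recursion  (a , b) ↦ (a + b , a + 2b),  written with
-- projections so that it computes on neutral pairs.
step : ℕ × ℕ → ℕ × ℕ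
step x = (proj₁ x + proj₂ x , proj₁ x + proj₂ x + proj₂ x)

coeffs : ℕ → ℕ × ℕ
coeffs = fold (1 , 0) step

½ : ℚ
½ = + 1 / 2

ζ : ℚ → ℚ → Q√5
ζ U V = (U Q.+ ½ Q.* V , ½ Q.* V)

ζ-of : ℕ × ℕ → Q√5
ζ-of x = ζ (fromℕ (proj₁ x)) (fromℕ (proj₂ x))

-- y = (3+√5)/2, exactly as it occurs in T.
y : Q√5
y = ι (+ 1 / 2) ⊛ (ι (+ 3 / 1) ⊕ √5)

y-⊛-ζ : ∀ U V → y ⊛ ζ U V ≡ ζ (U Q.+ V) (U Q.+ V Q.+ V)
y-⊛-ζ U V = cong₂ _,_
  (solve 2 (λ u v → con (proj₁ y) :* (u :+ con ½ :* v) :+ con (fromℕ 5) :* (con (proj₂ y) :* (con ½ :* v))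
                 := (u :+ v) :+ con ½ :* (u :+ v :+ v)) refl U V)
  (solve 2 (λ u v → con (proj₁ y) :* (con ½ :* v) :+ con (proj₂ y) :* (u :+ con ½ :* v)
                 := con ½ :* (u :+ v :+ v)) refl U V)
  where open ℚ-Solver.+-*-Solver

y-^^ : ∀ n → y ^^ n ≡ ζ-of (coeffs n)
y-^^ zero    = refl
y-^^ (suc n) = begin
  y ⊛ y ^^ n                   ≡⟨ cong (y ⊛_) (y-^^ n) ⟩
  y ⊛ ζ U V                    ≡⟨ y-⊛-ζ U V ⟩
  ζ (U Q.+ V) (U Q.+ V Q.+ V)  ≡⟨ cong₂ ζ (fromℕ-homo-+ a b) (trans (fromℕ-homo-+ (a + b) b) (cong (Q._+ V) (fromℕ-homo-+ a b))) ⟨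
  ζ-of (step (coeffs n))       ∎
  where
  a = proj₁ (coeffs n)
  b = proj₂ (coeffs n)
  U = fromℕ a
  V = fromℕ b

S : ℕ × ℕ → ℕ
S x = 2 * proj₁ x + 6 * proj₂ x + 3

fromℕ-S : ∀ x → fromℕ (S x) ≡ fromℕ 2 Q.* fromℕ (proj₁ x) Q.+ fromℕ 6 Q.* fromℕ (proj₂ x) Q.+ fromℕ 3
fromℕ-S x = begin
  fromℕ (2 * a + 6 * b + 3)                                ≡⟨ fromℕ-homo-+ (2 * a + 6 * b) 3 ⟩
  fromℕ (2 * a + 6 * b) Q.+ fromℕ 3                        ≡⟨ cong (Q._+ fromℕ 3) (fromℕ-homo-+ (2 * a) (6 * b)) ⟩
  fromℕ (2 * a) Q.+ fromℕ (6 * b) Q.+ fromℕ 3              ≡⟨ cong₂ (λ u v → u Q.+ v Q.+ fromℕ 3) (fromℕ-homo-* 2 a) (fromℕ-homo-* 6 b) ⟩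
  fromℕ 2 Q.* fromℕ a Q.+ fromℕ 6 Q.* fromℕ b Q.+ fromℕ 3  ∎
  where
  a = proj₁ x
  b = proj₂ x

twice-rational-part : ∀ U V → let r = proj₁ ((ι 1ℚ ⊕ √5) ⊛ ζ U V) in
                      r Q.+ r Q.+ fromℕ 3 ≡ fromℕ 2 Q.* U Q.+ fromℕ 6 Q.* V Q.+ fromℕ 3
twice-rational-part U V =
  solve 2 (λ u v → let r = con 1ℚ :* (u :+ con ½ :* v) :+ con (fromℕ 5) :* (con 1ℚ :* (con ½ :* v)) in
                   r :+ r :+ con (fromℕ 3) := con (fromℕ 2) :* u :+ con (fromℕ 6) :* v :+ con (fromℕ 3)) refl U V
  where open ℚ-Solver.+-*-Solver

-- T(p) = S(2p)/5.  Since 1-√5 and (3-√5)/2 are the conjugates of 1+√5 and y, the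
-- second summand of T is the conjugate of the first and the √5-parts cancel.
T-closed : ∀ p → T p ≡ ι (+ 1 / 5 Q.* fromℕ (S (coeffs (2 * p))))
T-closed p = begin
  T p                                       ≡⟨ cong (λ v → ι (+ 1 / 5) ⊛ (w ⊕ v ⊕ ι (fromℕ 3))) conjugate-summand ⟩
  ι (+ 1 / 5) ⊛ (w ⊕ conj w ⊕ ι (fromℕ 3))  ≡⟨ cong (λ v → ι (+ 1 / 5) ⊛ (v ⊕ ι (fromℕ 3))) (trace w) ⟩
  ι (+ 1 / 5) ⊛ ι (r Q.+ r Q.+ fromℕ 3)     ≡⟨ ι-⊛ (+ 1 / 5) (r Q.+ r Q.+ fromℕ 3) ⟩
  ι (+ 1 / 5 Q.* (r Q.+ r Q.+ fromℕ 3))     ≡⟨ cong (λ v → ι (+ 1 / 5 Q.* v)) rational-part ⟩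
  ι (+ 1 / 5 Q.* fromℕ (S (coeffs n)))      ∎
  where
  n = 2 * p
  w = (ι 1ℚ ⊕ √5) ⊛ y ^^ n
  r = proj₁ w
  conjugate-summand : (ι 1ℚ ⊖ √5) ⊛ (ι (+ 1 / 2) ⊛ (ι (+ 3 / 1) ⊖ √5)) ^^ n ≡ conj w
  conjugate-summand = trans (cong (conj (ι 1ℚ ⊕ √5) ⊛_) (conj-^^ y n)) (sym (conj-⊛ (ι 1ℚ ⊕ √5) (y ^^ n)))
  rational-part : r Q.+ r Q.+ fromℕ 3 ≡ fromℕ (S (coeffs n))
  rational-part = begin
    r Q.+ r Q.+ fromℕ 3                          ≡⟨ cong (λ v → let r′ = proj₁ ((ι 1ℚ ⊕ √5) ⊛ v) in r′ Q.+ r′ Q.+ fromℕ 3) (y-^^ n) ⟩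
    r₀ Q.+ r₀ Q.+ fromℕ 3                        ≡⟨ twice-rational-part U V ⟩
    fromℕ 2 Q.* U Q.+ fromℕ 6 Q.* V Q.+ fromℕ 3  ≡⟨ fromℕ-S (coeffs n) ⟨
    fromℕ (S (coeffs n))                         ∎
    where
    U = fromℕ (proj₁ (coeffs n))
    V = fromℕ (proj₂ (coeffs n))
    r₀ = proj₁ ((ι 1ℚ ⊕ √5) ⊛ ζ U V)

T-integral : ∀ p q → S (coeffs (2 * p)) ≡ q * 5 → T p ≡ ι (+ q / 1)
T-integral p q S≡q*5 = begin
  T p                                         ≡⟨ T-closed p ⟩
  ι (+ 1 / 5 Q.* fromℕ (S (coeffs (2 * p))))  ≡⟨ cong (λ s → ι (+ 1 / 5 Q.* fromℕ s)) S≡q*5 ⟩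
  ι (+ 1 / 5 Q.* fromℕ (q * 5))               ≡⟨ cong (λ v → ι (+ 1 / 5 Q.* v)) (fromℕ-homo-* q 5) ⟩
  ι (+ 1 / 5 Q.* (fromℕ q Q.* fromℕ 5))       ≡⟨ cong ι (solve 1 (λ x → con (+ 1 / 5) :* (x :* con (fromℕ 5)) := x) refl (fromℕ q)) ⟩
  ι (fromℕ q)                                 ∎
  where open ℚ-Solver.+-*-Solver

fold-reduce : ∀ {A : Set} (f r : A → A) → (∀ x → r (f x) ≡ r (f (r x))) →
              ∀ x₀ n → r (fold x₀ f n) ≡ fold (r x₀) (r ∘ f) n
fold-reduce f r compatible x₀ zero    = refl
fold-reduce f r compatible x₀ (suc n) =
  trans (compatible (fold x₀ f n)) (cong (r ∘ f) (fold-reduce f r compatible x₀ n))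

fold-periodic : ∀ {A : Set} (g : A → A) x P → fold x g P ≡ x →
                ∀ k m → fold x g (m + k * P) ≡ fold x g m
fold-periodic g x P cycle k m = trans (fold-+ x g m) (cong (λ z → fold z g m) (full-cycles k))
  where
  full-cycles : ∀ k → fold x g (k * P) ≡ x
  full-cycles zero    = refl
  full-cycles (suc k) = begin
    fold x g (P + k * P)        ≡⟨ fold-+ x g P ⟩
    fold (fold x g (k * P)) g P ≡⟨ cong (λ z → fold z g P) (full-cycles k) ⟩
    fold x g P                  ≡⟨ cycle ⟩
    x                           ∎

module Modulo (M : ℕ) .{{_ : NonZero M}} where

  infix 4 _≡ₘ_
  _≡ₘ_ : ℕ → ℕ → Set
  a ≡ₘ b = a % M ≡ b % M

  %-≡ₘ : ∀ a → a ≡ₘ a % M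
  %-≡ₘ a = sym (m%n%n≡m%n a M)

  +-congₘ : ∀ {a a′ b b′} → a ≡ₘ a′ → b ≡ₘ b′ → a + b ≡ₘ a′ + b′
  +-congₘ {a} {a′} {b} {b′} a≡a′ b≡b′ = begin
    (a + b) % M             ≡⟨ %-distribˡ-+ a b M ⟩
    (a % M + b % M) % M     ≡⟨ cong₂ (λ u v → (u + v) % M) a≡a′ b≡b′ ⟩
    (a′ % M + b′ % M) % M   ≡⟨ %-distribˡ-+ a′ b′ M ⟨
    (a′ + b′) % M           ∎

  *-congₘ : ∀ {a a′ b b′} → a ≡ₘ a′ → b ≡ₘ b′ → a * b ≡ₘ a′ * b′
  *-congₘ {a} {a′} {b} {b′} a≡a′ b≡b′ = begin
    (a * b) % M             ≡⟨ %-distribˡ-* a b M ⟩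
    (a % M * (b % M)) % M   ≡⟨ cong₂ (λ u v → (u * v) % M) a≡a′ b≡b′ ⟩
    (a′ % M * (b′ % M)) % M ≡⟨ %-distribˡ-* a′ b′ M ⟨
    (a′ * b′) % M           ∎

  ∣-≡ₘ : ∀ {d a b} → d ℕ∣.∣ M → a ≡ₘ b → d ℕ∣.∣ b → d ℕ∣.∣ a
  ∣-≡ₘ {d} {a} {b} d∣M a≡b d∣b = ∣n∣m%n⇒∣m d∣M (subst (d ℕ∣.∣_) (sym a≡b) (%-presˡ-∣ d∣b d∣M))

  reduce : ℕ × ℕ → ℕ × ℕ
  reduce x = (proj₁ x % M , proj₂ x % M)

  -- The coefficient recursion and S only involve + and *, so they respect reduction.
  step-reduce : ∀ x → reduce (step x) ≡ reduce (step (reduce x))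
  step-reduce x = cong₂ _,_ sum (+-congₘ sum (%-≡ₘ (proj₂ x)))
    where
    sum : proj₁ x + proj₂ x ≡ₘ proj₁ x % M + proj₂ x % M
    sum = +-congₘ (%-≡ₘ (proj₁ x)) (%-≡ₘ (proj₂ x))

  S-reduce : ∀ x → S x ≡ₘ S (reduce x)
  S-reduce x = +-congₘ (+-congₘ (*-congₘ {2} refl (%-≡ₘ (proj₁ x))) (*-congₘ {6} refl (%-≡ₘ (proj₂ x)))) refl

-- The modulus M = 8525 = 25 · 11 · 31, a multiple of 5·5, 11·5 and 31·5.
M : ℕ
M = 8525

open Modulo M

step-mod : ℕ × ℕ → ℕ × ℕ
step-mod = reduce ∘ step

step-mod-period : fold (1 , 0) step-mod 150 ≡ (1 , 0)
step-mod-period = refl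

S-mod : ℕ → ℕ
S-mod j = S (fold (1 , 0) step-mod (2 * j))

S-periodic : ∀ p → S (coeffs (2 * p)) ≡ₘ S-mod (p % 75)
S-periodic p = begin
  S (coeffs (2 * p)) % M                           ≡⟨ S-reduce (coeffs (2 * p)) ⟩
  S (reduce (coeffs (2 * p))) % M                  ≡⟨ cong (λ x → S x % M) (fold-reduce step reduce step-reduce (1 , 0) (2 * p)) ⟩
  S (orbit (2 * p)) % M                            ≡⟨ cong (λ n → S (orbit n) % M) two-p ⟩
  S (orbit (2 * (p % 75) + (p ℕ./ 75) * 150)) % M  ≡⟨ cong (λ x → S x % M) (fold-periodic step-mod (1 , 0) 150 step-mod-period (p ℕ./ 75) (2 * (p % 75))) ⟩
  S-mod (p % 75) % M                               ∎
  where
  orbit : ℕ → ℕ × ℕ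
  orbit = fold (1 , 0) step-mod
  two-p : 2 * p ≡ 2 * (p % 75) + (p ℕ./ 75) * 150
  two-p = trans (cong (2 *_) (m≡m%n+[m/n]*n p 75))
    (solve 2 (λ r k → con 2 :* (r :+ k :* con 75) := con 2 :* r :+ k :* con 150) refl (p % 75) (p ℕ./ 75))
    where open ℕ-Solver.+-*-Solver

Good : ℕ → Set
Good j = 5 ℕ∣.∣ s × (j % 5 ≡ 1 → 25 ℕ∣.∣ s) × (j % 5 ≡ 3 → 55 ℕ∣.∣ s) × (j % 15 ≡ 2 → 155 ℕ∣.∣ s)
  where s = S-mod j

good? : ∀ j → Dec (Good j)
good? j = (5 ∣? _) ×-dec ((_ ≟ 1) →-dec (25 ∣? _)) ×-dec ((_ ≟ 3) →-dec (55 ∣? _)) ×-dec ((_ ≟ 2) →-dec (155 ∣? _))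

all-good : ∀ {j} → j < 75 → Good j
all-good = from-yes (allUpTo? good? 75)

theorem2 : (p : ℕ) → Prime p →
    ∃[ t ] ( T p ≡ ι (t / 1)
           × (p % 5 ≡ 1 → + 5 ∣ t)
           × (p % 5 ≡ 3 → + 11 ∣ t)
           × (p % 15 ≡ 2 → + 31 ∣ t) )
theorem2 p _ =
    + q
  , T-integral p q s≡q*5
  , (λ p≡1 → divides-q 5  (divides 341 refl) (proj₁ (proj₂ good-j) (residue 5  (divides 15 refl) p≡1)))
  , (λ p≡3 → divides-q 11 (divides 155 refl) (proj₁ (proj₂ (proj₂ good-j)) (residue 5  (divides 15 refl) p≡3)))
  , (λ p≡2 → divides-q 31 (divides 55 refl)  (proj₂ (proj₂ (proj₂ good-j)) (residue 15 (divides 5 refl)  p≡2)))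
  where
  j : ℕ
  j = p % 75
  good-j : Good j
  good-j = all-good (m%n<n p 75)
  residue : ∀ m .{{_ : NonZero m}} {r} → m ℕ∣.∣ 75 → p % m ≡ r → j % m ≡ r
  residue m m∣75 = trans (m∣n⇒o%n%m≡o%m m 75 p m∣75)
  -- S(2p) = 5q, as 5 divides both M and S-mod j
  q : ℕ
  q = S (coeffs (2 * p)) ℕ./ 5
  s≡q*5 : S (coeffs (2 * p)) ≡ q * 5
  s≡q*5 = sym (m/n*n≡m (∣-≡ₘ (divides 1705 refl) (S-periodic p) (proj₁ good-j)))
  divides-q : ∀ d → d * 5 ℕ∣.∣ M → d * 5 ℕ∣.∣ S-mod j → d ℕ∣.∣ q
  divides-q d d5∣M d5∣Sj = *-cancelʳ-∣ 5 (subst (d * 5 ℕ∣.∣_) s≡q*5 (∣-≡ₘ d5∣M (S-periodic p) d5∣Sj))
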